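{- For any request sequence $S_1,\dots,S_m$ and initial permutation $\pi_0$, $$\mathrm{cost}(\mathrm{MTF}_{\mathrm{OPT}})\le 2\cdot\mathrm{cost}(\mathrm{OPT}_{dyn}).$$
   Context: Let $U$ be a set of $n$ elements; a permutation $\pi$ of $U$ gives each element $e$ a position $\pi[e]$, and $\pi(S)=\min_{e\in S}\pi[e]$. $d_{KT}(\pi,\sigma)$ is the number of pairs of elements ordered differently by $\pi,\sigma$. A dynamic solution for requests $S_1,\dots,S_m\subseteq U$ is a sequence of permutations $y_0=\pi_0,y_1,\dots,y_m$ with cost $\sum_{t=1}^m\big(y_t(S_t)+d_{KT}(y_{t-1},y_t)\big)$; $\mathrm{OPT}_{dyn}$ denotes a dynamic solution of minimum cost. Let $e_t$ be the element of $S_t$ at position $y_t(S_t)$ in $y_t$, where $(y_t)$ is the optimal dynamic solution. $\mathrm{MTF}_{\mathrm{OPT}}$ is the sequence $x_0=\pi_0,x_1,\dots,x_m$ where $x_t$ is obtained from $x_{t-1}$ by moving $e_t$ to the first position while keeping the relative order of all other elements; its cost is $\sum_{t=1}^m\big(x_t(S_t)+d_{KT}(x_{t-1},x_t)\big)$. -}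

module Defs where

open import Data.Nat using (ℕ; zero; suc; _+_; _⊓_; _<ᵇ_)
open import Data.Bool using (Bool; true; false; if_then_else_; _∧_; _xor_)
open import Data.Fin using (Fin; toℕ; _≟_)
open import Data.Fin.Subset using (Subset; _∈_; Nonempty)
open import Data.Fin.Subset.Properties using (_∈?_)
open import Data.List using (List; []; _∷_; foldr; filter; map; allFin)
open import Data.Nat.ListAction using (sum)
open import Data.List.Relation.Binary.Permutation.Propositional using (_↭_)
open import Data.Vec using (Vec; []; _∷_)
open import Relation.Nullary.Decidable using (does; ¬?)

-- A permutation of U = Fin n is represented by the list of the elements of U
-- in order (first element of the list = position 1).
Perm : ℕ → Set
Perm n = List (Fin n)

IsPerm : ∀ {n} → Perm n → Set
IsPerm {n} xs = xs ↭ allFin n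

pos : ∀ {n} → Perm n → Fin n → ℕ
pos [] e = 0
pos (x ∷ xs) e = if does (x ≟ e) then 1 else suc (pos xs e)

-- π(S) = min_{e ∈ S} π[e]   (initial value n is ≥ every position, so for
-- nonempty S and a genuine permutation this is exactly the minimum)
minPos : ∀ {n} → Perm n → Subset n → ℕ
minPos {n} π S =
  foldr (λ e acc → if does (e ∈? S) then pos π e ⊓ acc else acc) n (allFin n)

dKT : ∀ {n} → Perm n → Perm n → ℕ
dKT {n} π σ = sum (map (λ a → sum (map (λ b → disagree a b) (allFin n))) (allFin n))
  where
  disagree : Fin n → Fin n → ℕ
  disagree a b =
    if (toℕ a <ᵇ toℕ b) ∧ ((pos π a <ᵇ pos π b) xor (pos σ a <ᵇ pos σ b))
    then 1 else 0

cost : ∀ {n m} → Perm n → Vec (Subset n) m → Vec (Perm n) m → ℕ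
cost π0 [] [] = 0
cost π0 (S ∷ Ss) (y ∷ ys) = minPos y S + dKT π0 y + cost y Ss ys

moveToFront : ∀ {n} → Fin n → Perm n → Perm n
moveToFront e xs = e ∷ filter (λ x → ¬? (x ≟ e)) xs

mtfSeq : ∀ {n m} → Perm n → Vec (Fin n) m → Vec (Perm n) m
mtfSeq π0 [] = []
mtfSeq π0 (e ∷ es) = let x = moveToFront e π0 in x ∷ mtfSeq x es

-- Take Φ_t = dKT(x_t, y_t) as potential, Φ_0 = 0. Moving e_t to the front of x_{t-1}
-- only reorders pairs containing e_t, so dKT(x_{t-1}, x_t) + dKT(x_t, y_t) exceeds
-- dKT(x_{t-1}, y_t) by at most twice the number of elements ahead of e_t in y_t, which is
-- less than y_t(S_t). As x_t(S_t) = 1, the triangle inequality through y_{t-1} gives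
-- x_t(S_t) + dKT(x_{t-1}, x_t) + Φ_t - Φ_{t-1} ≤ 2 y_t(S_t) + dKT(y_{t-1}, y_t).
module Submission where

open import Defs
open import Data.Bool using (Bool; true; false; if_then_else_; _∧_; _xor_; not)
open import Data.Bool.Properties using (xor-same; ∧-zeroʳ)
open import Data.Fin using (Fin; zero; suc; toℕ; _≟_)
open import Data.Fin.Subset using (Subset; _∈_; Nonempty)
open import Data.Fin.Subset.Properties using (_∈?_)
open import Data.List using (List; []; _∷_; map; allFin; filter; foldr)
open import Data.List.Properties using (map-cong; map-tabulate)
open import Data.List.Membership.Propositional using () renaming (_∈_ to _∈ₗ_)
open import Data.List.Membership.Propositional.Properties using (∈-filter⁺; ∈-allFin)
open import Data.List.Relation.Unary.Any using (here; there; tail)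
open import Data.List.Relation.Binary.Permutation.Propositional using (↭-sym)
open import Data.List.Relation.Binary.Permutation.Propositional.Properties using (∈-resp-↭)
open import Data.Nat using (ℕ; zero; suc; _+_; _*_; _≤_; _<_; _<ᵇ_; _⊓_; z≤n; z<s; s<s)
open import Data.Nat.Properties hiding (_≟_)
open import Data.Nat.ListAction using (sum)
open import Data.Nat.Tactic.RingSolver using (solve-∀)
open import Data.Product using (_×_; _,_; proj₁; proj₂; ∃)
open import Data.Vec using (Vec; lookup; []; _∷_)
open import Data.Vec.Relation.Unary.All using (All; []; _∷_)
open import Function using (_∘_)
open import Relation.Binary.PropositionalEquality
open import Relation.Nullary using (Dec; yes; no; does; ¬?; contradiction)
open import Relation.Nullary.Decidable using (dec-true; dec-false)

private
  variable
    n : ℕ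
    a b c e x : Fin n
    xs : List (Fin n)

-- Sums over Fin n

module _ {A : Set} where

  sum-map-cong : ∀ {f g : A → ℕ} → (∀ a → f a ≡ g a) → ∀ xs → sum (map f xs) ≡ sum (map g xs)
  sum-map-cong f≗g xs = cong sum (map-cong f≗g xs)

  sum-map-mono : ∀ {f g : A → ℕ} → (∀ a → f a ≤ g a) → ∀ xs → sum (map f xs) ≤ sum (map g xs)
  sum-map-mono f≤g []       = z≤n
  sum-map-mono f≤g (x ∷ xs) = +-mono-≤ (f≤g x) (sum-map-mono f≤g xs)

  sum-map-zero : ∀ {f : A → ℕ} → (∀ a → f a ≡ 0) → ∀ xs → sum (map f xs) ≡ 0
  sum-map-zero f≗0 []       = refl
  sum-map-zero f≗0 (x ∷ xs) = cong₂ _+_ (f≗0 x) (sum-map-zero f≗0 xs)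

  sum-map-+ : ∀ (f g : A → ℕ) xs → sum (map (λ a → f a + g a) xs) ≡ sum (map f xs) + sum (map g xs)
  sum-map-+ f g []       = refl
  sum-map-+ f g (x ∷ xs) = begin
    f x + g x + sum (map (λ a → f a + g a) xs)      ≡⟨ cong (f x + g x +_) (sum-map-+ f g xs) ⟩
    f x + g x + (sum (map f xs) + sum (map g xs))    ≡⟨ +-exchange (f x) (g x) _ _ ⟩
    f x + sum (map f xs) + (g x + sum (map g xs))    ∎
    where
    open ≡-Reasoning
    +-exchange : ∀ a b c d → a + b + (c + d) ≡ a + c + (b + d)
    +-exchange = solve-∀

  sum-map-* : ∀ k (f : A → ℕ) xs → sum (map (λ a → k * f a) xs) ≡ k * sum (map f xs)
  sum-map-* k f []       = sym (*-zeroʳ k)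
  sum-map-* k f (x ∷ xs) = trans (cong (k * f x +_) (sum-map-* k f xs)) (sym (*-distribˡ-+ k (f x) _))

∑ : ∀ {n} → (Fin n → ℕ) → ℕ
∑ {n} f = sum (map f (allFin n))

∑-suc : ∀ {n} (f : Fin (suc n) → ℕ) → ∑ f ≡ f zero + ∑ (f ∘ suc)
∑-suc f = cong (λ xs → f zero + sum xs)
  (trans (map-tabulate suc f) (sym (map-tabulate (λ i → i) (f ∘ suc))))

∑-indicator : ∀ {n} (e : Fin n) (k : Fin n → ℕ) → ∑ (λ a → if does (a ≟ e) then k a else 0) ≡ k e
∑-indicator {suc n} zero k = begin
  ∑ (λ a → if does (a ≟ zero) then k a else 0)  ≡⟨ ∑-suc (λ a → if does (a ≟ zero) then k a else 0) ⟩
  k zero + ∑ {n} (λ _ → 0)                     ≡⟨ cong (k zero +_) (sum-map-zero (λ _ → refl) (allFin n)) ⟩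
  k zero + 0                                    ≡⟨ +-identityʳ (k zero) ⟩
  k zero                                        ∎
  where open ≡-Reasoning
∑-indicator {suc n} (suc e) k =
  trans (∑-suc (λ a → if does (a ≟ suc e) then k a else 0)) (∑-indicator e (k ∘ suc))

∑-if : ∀ d (f : Fin n → ℕ) → ∑ (λ b → if d then f b else 0) ≡ (if d then ∑ f else 0)
∑-if true  f = refl
∑-if {n} false f = sum-map-zero (λ _ → refl) (allFin n)

∑∑ : ∀ {n} → (Fin n → Fin n → ℕ) → ℕ
∑∑ F = ∑ (λ a → ∑ (F a))

∑∑-mono : ∀ {n} {F G : Fin n → Fin n → ℕ} → (∀ a b → F a b ≤ G a b) → ∑∑ F ≤ ∑∑ G
∑∑-mono {n} F≤G = sum-map-mono (λ a → sum-map-mono (F≤G a) (allFin n)) (allFin n)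

∑∑-+ : ∀ {n} (F G : Fin n → Fin n → ℕ) → ∑∑ (λ a b → F a b + G a b) ≡ ∑∑ F + ∑∑ G
∑∑-+ {n} F G = trans (sum-map-cong (λ a → sum-map-+ (F a) (G a) (allFin n)) (allFin n))
                     (sum-map-+ (∑ ∘ F) (∑ ∘ G) (allFin n))

∑∑-* : ∀ {n} k (F : Fin n → Fin n → ℕ) → ∑∑ (λ a b → k * F a b) ≡ k * ∑∑ F
∑∑-* {n} k F = trans (sum-map-cong (λ a → sum-map-* k (F a) (allFin n)) (allFin n))
                     (sum-map-* k (∑ ∘ F) (allFin n))

ind : Bool → ℕ
ind b = if b then 1 else 0

ind≤1 : ∀ b → ind b ≤ 1
ind≤1 true  = ≤-refl
ind≤1 false = z≤n

xor-triangle : ∀ u v w → ind (u xor w) ≤ ind (u xor v) + ind (v xor w)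
xor-triangle true  true  true  = z≤n
xor-triangle true  true  false = ≤-refl
xor-triangle true  false true  = z≤n
xor-triangle true  false false = ≤-refl
xor-triangle false true  true  = ≤-refl
xor-triangle false true  false = z≤n
xor-triangle false false true  = ≤-refl
xor-triangle false false false = z≤n

xor-detour : ∀ u v w → ind (u xor v) + ind (v xor w) ≤ ind (u xor w) + 2 * ind (v xor w)
xor-detour true  true  w     = m≤m+n _ _
xor-detour false false w     = m≤m+n _ _
xor-detour true  false true  = ≤-refl
xor-detour true  false false = ≤-refl
xor-detour false true  true  = ≤-refl
xor-detour false true  false = ≤-refl

ind-exclusive : ∀ p q u → (p ≡ true → q ≡ false) → ind (p ∧ u) + ind (q ∧ u) ≤ ind u
ind-exclusive true  q     u p⇒¬q rewrite p⇒¬q refl = ≤-reflexive (+-identityʳ (ind u))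
ind-exclusive false true  u _    = ≤-refl
ind-exclusive false false u _    = z≤n

<ᵇ-irrefl : ∀ m → (m <ᵇ m) ≡ false
<ᵇ-irrefl zero    = refl
<ᵇ-irrefl (suc m) = <ᵇ-irrefl m

<ᵇ-asym : ∀ m n → (m <ᵇ n) ≡ true → (n <ᵇ m) ≡ false
<ᵇ-asym zero    (suc n) _   = refl
<ᵇ-asym (suc m) (suc n) m<n = <ᵇ-asym m n m<n

m≢n⇒m<ᵇn≡not[n<ᵇm] : ∀ m n → m ≢ n → (m <ᵇ n) ≡ not (n <ᵇ m)
m≢n⇒m<ᵇn≡not[n<ᵇm] zero    zero    m≢n = contradiction refl m≢n
m≢n⇒m<ᵇn≡not[n<ᵇm] zero    (suc n) _   = refl
m≢n⇒m<ᵇn≡not[n<ᵇm] (suc m) zero    _   = refl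
m≢n⇒m<ᵇn≡not[n<ᵇm] (suc m) (suc n) m≢n = m≢n⇒m<ᵇn≡not[n<ᵇm] m n (m≢n ∘ cong suc)

-- Positions and move-to-front

before : Perm n → Fin n → Fin n → Bool
before π a b = pos π a <ᵇ pos π b

pos-here : ∀ xs → x ≡ c → pos (x ∷ xs) c ≡ 1
pos-here {x = x} {c = c} xs x≡c rewrite dec-true (x ≟ c) x≡c = refl

pos-there : ∀ xs → x ≢ c → pos (x ∷ xs) c ≡ suc (pos xs c)
pos-there {x = x} {c = c} xs x≢c rewrite dec-false (x ≟ c) x≢c = refl

pos-cons-suc : ∀ (x : Fin n) xs c → ∃ λ k → pos (x ∷ xs) c ≡ suc k
pos-cons-suc x xs c with does (x ≟ c)
... | true  = 0 , refl
... | false = pos xs c , refl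

∈⇒pos-suc : c ∈ₗ xs → ∃ λ k → pos xs c ≡ suc k
∈⇒pos-suc {c = c} {xs = x ∷ xs} _ = pos-cons-suc x xs c

∈-tail : x ≢ c → c ∈ₗ x ∷ xs → c ∈ₗ xs
∈-tail x≢c = tail (x≢c ∘ sym)

∈⇒pos≢0 : c ∈ₗ xs → pos xs c ≢ 0
∈⇒pos≢0 c∈ pos≡0 = 0≢1+n (trans (sym pos≡0) (proj₂ (∈⇒pos-suc c∈)))

pos-injective : c ∈ₗ xs → a ∈ₗ xs → pos xs c ≡ pos xs a → c ≡ a
pos-injective {c = c} {xs = x ∷ xs} {a = a} c∈ a∈ eq with x ≟ c | x ≟ a
... | yes x≡c | yes x≡a = trans (sym x≡c) x≡a
... | yes _   | no x≢a  = contradiction (sym (suc-injective eq)) (∈⇒pos≢0 (∈-tail x≢a a∈))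
... | no x≢c  | yes _   = contradiction (suc-injective eq) (∈⇒pos≢0 (∈-tail x≢c c∈))
... | no x≢c  | no x≢a  = pos-injective (∈-tail x≢c c∈) (∈-tail x≢a a∈) (suc-injective eq)

a≢b⇒before≡not-before : a ∈ₗ xs → b ∈ₗ xs → a ≢ b → before xs a b ≡ not (before xs b a)
a≢b⇒before≡not-before {xs = xs} a∈ b∈ a≢b = m≢n⇒m<ᵇn≡not[n<ᵇm] (pos xs _) (pos xs _) (a≢b ∘ pos-injective a∈ b∈)

without : Fin n → List (Fin n) → List (Fin n)
without e = filter (λ x → ¬? (x ≟ e))

∈-without : c ∈ₗ xs → c ≢ e → c ∈ₗ without e xs
∈-without {e = e} = ∈-filter⁺ (λ x → ¬? (x ≟ e))

∈-moveToFront : ∀ e → c ∈ₗ xs → c ∈ₗ moveToFront e xs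
∈-moveToFront {c = c} e c∈ with c ≟ e
... | yes c≡e = here c≡e
... | no  c≢e = there (∈-without c∈ c≢e)

Complete : Perm n → Set
Complete {n} π = ∀ (c : Fin n) → c ∈ₗ π

IsPerm⇒Complete : ∀ {π : Perm n} → IsPerm π → Complete π
IsPerm⇒Complete π↭ c = ∈-resp-↭ (↭-sym π↭) (∈-allFin c)

moveToFront-complete : ∀ e {π : Perm n} → Complete π → Complete (moveToFront e π)
moveToFront-complete e π-complete c = ∈-moveToFront e (π-complete c)

before-without : ∀ e xs → a ≢ e → b ≢ e → a ∈ₗ xs → b ∈ₗ xs →
                 before (without e xs) a b ≡ before xs a b
before-without {a = a} {b = b} e (x ∷ xs) a≢e b≢e a∈ b∈ with x ≟ e
... | yes refl
  rewrite pos-there xs (a≢e ∘ sym) | pos-there xs (b≢e ∘ sym) =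
  before-without e xs a≢e b≢e (∈-tail (a≢e ∘ sym) a∈) (∈-tail (b≢e ∘ sym) b∈)
... | no _ with x ≟ a | x ≟ b
...   | yes _   | yes _   = refl
...   | no _    | yes _   = refl
...   | no x≢a  | no x≢b  = before-without e xs a≢e b≢e (∈-tail x≢a a∈) (∈-tail x≢b b∈)
...   | yes _   | no x≢b
  with ∈⇒pos-suc (∈-without (∈-tail x≢b b∈) b≢e) | ∈⇒pos-suc (∈-tail x≢b b∈)
...     | _ , eq′ | _ , eq rewrite eq′ | eq = refl

before-moveToFront : ∀ e xs → a ≢ e → b ≢ e → a ∈ₗ xs → b ∈ₗ xs →
                     before (moveToFront e xs) a b ≡ before xs a b
before-moveToFront e xs a≢e b≢e
  rewrite pos-there (without e xs) (a≢e ∘ sym) | pos-there (without e xs) (b≢e ∘ sym) =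
  before-without e xs a≢e b≢e

before-moveToFrontˡ : ∀ e xs → b ≢ e → b ∈ₗ xs → before (moveToFront e xs) e b ≡ true
before-moveToFrontˡ e xs b≢e b∈
  rewrite pos-here (without e xs) (refl {x = e}) | pos-there (without e xs) (b≢e ∘ sym)
  with ∈⇒pos-suc (∈-without b∈ b≢e)
... | _ , eq rewrite eq = refl

before-moveToFrontʳ : ∀ e xs → a ≢ e → before (moveToFront e xs) a e ≡ false
before-moveToFrontʳ e xs a≢e
  rewrite pos-here (without e xs) (refl {x = e}) | pos-there (without e xs) (a≢e ∘ sym) = refl

-- Kendall tau distance

-- dKT π σ is definitionally ∑∑ (disagree π σ).
disagree : Perm n → Perm n → Fin n → Fin n → ℕ
disagree π σ a b = ind ((toℕ a <ᵇ toℕ b) ∧ (before π a b xor before σ a b))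

dKT-self : ∀ (π : Perm n) → dKT π π ≡ 0
dKT-self {n} π = sum-map-zero (λ a → sum-map-zero (disagree-self a) (allFin n)) (allFin n)
  where
  disagree-self : ∀ a b → disagree π π a b ≡ 0
  disagree-self a b =
    cong ind (trans (cong ((toℕ a <ᵇ toℕ b) ∧_) (xor-same (before π a b))) (∧-zeroʳ _))

dKT-triangle : ∀ (π σ ρ : Perm n) → dKT π ρ ≤ dKT π σ + dKT σ ρ
dKT-triangle π σ ρ = ≤-trans (∑∑-mono disagree-triangle) (≤-reflexive (∑∑-+ (disagree π σ) (disagree σ ρ)))
  where
  disagree-triangle : ∀ a b → disagree π ρ a b ≤ disagree π σ a b + disagree σ ρ a b
  disagree-triangle a b with toℕ a <ᵇ toℕ b
  ... | false = z≤n
  ... | true  = xor-triangle (before π a b) (before σ a b) (before ρ a b)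

-- Amortised analysis

-- The unordered pair {a, b} consists of e and an element that precedes e in y.
ahead : Fin n → Perm n → Fin n → Fin n → Bool
ahead e y a b = if does (a ≟ e) then before y b e else if does (b ≟ e) then before y a e else false

aheadPair : Fin n → Perm n → Fin n → Fin n → ℕ
aheadPair e y a b = ind ((toℕ a <ᵇ toℕ b) ∧ ahead e y a b)

dKT-moveToFront : ∀ e {x y : Perm n} → Complete x → Complete y →
  dKT x (moveToFront e x) + dKT (moveToFront e x) y ≤ dKT x y + 2 * ∑∑ (aheadPair e y)
dKT-moveToFront e {x} {y} x-complete y-complete = begin
  dKT x x′ + dKT x′ y                                 ≡⟨ ∑∑-+ (disagree x x′) (disagree x′ y) ⟨
  ∑∑ (λ a b → disagree x x′ a b + disagree x′ y a b)  ≤⟨ ∑∑-mono detour ⟩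
  ∑∑ (λ a b → disagree x y a b + 2 * aheadPair e y a b) ≡⟨ ∑∑-+ (disagree x y) _ ⟩
  dKT x y + ∑∑ (λ a b → 2 * aheadPair e y a b)        ≡⟨ cong (dKT x y +_) (∑∑-* 2 (aheadPair e y)) ⟩
  dKT x y + 2 * ∑∑ (aheadPair e y)                    ∎
  where
  open ≤-Reasoning
  x′ = moveToFront e x
  detour : ∀ a b → disagree x x′ a b + disagree x′ y a b ≤ disagree x y a b + 2 * aheadPair e y a b
  detour a b with toℕ a <ᵇ toℕ b in a<b
  ... | false = z≤n
  ... | true with a ≟ e | b ≟ e
  ...   | yes refl | yes refl = contradiction (trans (sym a<b) (<ᵇ-irrefl (toℕ a))) λ ()
  ...   | yes refl | no b≢e
    rewrite before-moveToFrontˡ e x b≢e (x-complete b) | a≢b⇒before≡not-before (y-complete b) (y-complete e) b≢e =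
    xor-detour (before x e b) true (before y e b)
  ...   | no a≢e | yes refl rewrite before-moveToFrontʳ e x a≢e =
    xor-detour (before x a e) false (before y a e)
  ...   | no a≢e | no b≢e
    rewrite before-moveToFront e x a≢e b≢e (x-complete a) (x-complete b) | xor-same (before x a b) =
    m≤m+n _ 0

countBefore : Perm n → Fin n → ℕ
countBefore y e = ∑ (λ c → ind (before y c e))

∑∑-aheadPair≤countBefore : ∀ e (y : Perm n) → ∑∑ (aheadPair e y) ≤ countBefore y e
∑∑-aheadPair≤countBefore {n} e y = begin
  ∑∑ (aheadPair e y)                   ≤⟨ ∑∑-mono split ⟩
  ∑∑ (λ a b → H₁ a b + H₂ a b)          ≡⟨ ∑∑-+ H₁ H₂ ⟩
  ∑∑ H₁ + ∑∑ H₂                        ≡⟨ cong₂ _+_ ∑∑H₁ ∑∑H₂ ⟩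
  ∑ (λ c → ind ((toℕ e <ᵇ toℕ c) ∧ before y c e)) + ∑ (λ c → ind ((toℕ c <ᵇ toℕ e) ∧ before y c e))
                                        ≡⟨ sum-map-+ _ _ (allFin n) ⟨
  ∑ (λ c → ind ((toℕ e <ᵇ toℕ c) ∧ before y c e) + ind ((toℕ c <ᵇ toℕ e) ∧ before y c e))
                                        ≤⟨ sum-map-mono (λ c → ind-exclusive _ _ _ (<ᵇ-asym (toℕ e) (toℕ c))) (allFin n) ⟩
  countBefore y e                       ∎
  where
  open ≤-Reasoning
  H₁ H₂ : Fin n → Fin n → ℕ
  H₁ a b = if does (a ≟ e) then ind ((toℕ a <ᵇ toℕ b) ∧ before y b e) else 0
  H₂ a b = if does (b ≟ e) then ind ((toℕ a <ᵇ toℕ b) ∧ before y a e) else 0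

  split : ∀ a b → aheadPair e y a b ≤ H₁ a b + H₂ a b
  split a b with a ≟ e | b ≟ e
  ... | yes _ | _     = m≤m+n _ _
  ... | no _  | yes _ = ≤-refl
  ... | no _  | no _  rewrite ∧-zeroʳ (toℕ a <ᵇ toℕ b) = z≤n

  ∑∑H₁ : ∑∑ H₁ ≡ ∑ (λ c → ind ((toℕ e <ᵇ toℕ c) ∧ before y c e))
  ∑∑H₁ = trans (sum-map-cong (λ a → ∑-if (does (a ≟ e)) (λ b → ind ((toℕ a <ᵇ toℕ b) ∧ before y b e))) (allFin n))
               (∑-indicator e (λ a → ∑ (λ b → ind ((toℕ a <ᵇ toℕ b) ∧ before y b e))))

  ∑∑H₂ : ∑∑ H₂ ≡ ∑ (λ c → ind ((toℕ c <ᵇ toℕ e) ∧ before y c e))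
  ∑∑H₂ = sum-map-cong (λ a → ∑-indicator e (λ b → ind ((toℕ a <ᵇ toℕ b) ∧ before y a e))) (allFin n)

before-head : ∀ (x : Fin n) xs c → before (x ∷ xs) c x ≡ false
before-head x xs c rewrite pos-here {x = x} xs refl with pos-cons-suc x xs c
... | _ , eq rewrite eq = refl

countBefore-head : ∀ (x : Fin n) xs → countBefore (x ∷ xs) x ≡ 0
countBefore-head x xs = sum-map-zero (λ c → cong ind (before-head x xs c)) (allFin _)

countBefore-∷ : ∀ xs → x ≢ e → countBefore (x ∷ xs) e ≤ suc (countBefore xs e)
countBefore-∷ {n} {x} {e} xs x≢e = begin
  countBefore (x ∷ xs) e                                              ≤⟨ sum-map-mono pointwise (allFin n) ⟩
  ∑ (λ c → (if does (c ≟ x) then 1 else 0) + ind (before xs c e))     ≡⟨ sum-map-+ _ _ (allFin n) ⟩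
  ∑ (λ c → if does (c ≟ x) then 1 else 0) + countBefore xs e          ≡⟨ cong (_+ countBefore xs e) (∑-indicator x (λ _ → 1)) ⟩
  suc (countBefore xs e)                                              ∎
  where
  open ≤-Reasoning
  pointwise : ∀ c → ind (before (x ∷ xs) c e) ≤ (if does (c ≟ x) then 1 else 0) + ind (before xs c e)
  pointwise c rewrite pos-there xs x≢e with c ≟ x
  ... | yes _   = ≤-trans (ind≤1 _) (m≤m+n 1 _)
  ... | no  c≢x rewrite pos-there xs (c≢x ∘ sym) = ≤-refl

countBefore<pos : e ∈ₗ xs → countBefore xs e < pos xs e
countBefore<pos {e = e} {xs = x ∷ xs} e∈ = by-head (x ≟ e)
  where
  open ≤-Reasoning
  by-head : Dec (x ≡ e) → countBefore (x ∷ xs) e < pos (x ∷ xs) e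
  by-head (yes refl) = begin-strict
    countBefore (x ∷ xs) x  ≡⟨ countBefore-head x xs ⟩
    0                       <⟨ z<s ⟩
    1                       ≡⟨ pos-here xs refl ⟨
    pos (x ∷ xs) x          ∎
  by-head (no x≢e) = begin-strict
    countBefore (x ∷ xs) e  ≤⟨ countBefore-∷ xs x≢e ⟩
    suc (countBefore xs e)  <⟨ s<s (countBefore<pos (∈-tail x≢e e∈)) ⟩
    suc (pos xs e)          ≡⟨ pos-there xs x≢e ⟨
    pos (x ∷ xs) e          ∎

minPos≤pos : ∀ (π : Perm n) S → e ∈ S → minPos π S ≤ pos π e
minPos≤pos {n} {e} π S e∈S = foldr-min≤ (allFin n) n (∈-allFin e)
  where
  foldr-min≤ : ∀ xs k → e ∈ₗ xs →
    foldr (λ c acc → if does (c ∈? S) then pos π c ⊓ acc else acc) k xs ≤ pos π e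
  foldr-min≤ (x ∷ xs) k (here refl) rewrite dec-true (x ∈? S) e∈S = m⊓n≤m _ _
  foldr-min≤ (x ∷ xs) k (there e∈xs) with does (x ∈? S)
  ... | true  = ≤-trans (m⊓n≤n _ _) (foldr-min≤ xs k e∈xs)
  ... | false = foldr-min≤ xs k e∈xs

moveToFront-amortised : ∀ {x y : Perm n} {S} → Complete x → Complete y → e ∈ S → pos y e ≡ minPos y S →
  minPos (moveToFront e x) S + dKT x (moveToFront e x) + dKT (moveToFront e x) y ≤ 2 * minPos y S + dKT x y
moveToFront-amortised {e = e} {x} {y} {S} x-complete y-complete e∈S e-min = begin
  minPos x′ S + dKT x x′ + dKT x′ y        ≡⟨ +-assoc (minPos x′ S) _ _ ⟩
  minPos x′ S + (dKT x x′ + dKT x′ y)      ≤⟨ +-mono-≤ front (dKT-moveToFront e x-complete y-complete) ⟩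
  1 + (dKT x y + 2 * G)                    ≤⟨ n≤1+n _ ⟩
  2 + (dKT x y + 2 * G)                    ≡⟨ rearrange (dKT x y) G ⟩
  2 * suc G + dKT x y                      ≤⟨ +-monoˡ-≤ (dKT x y) (*-monoʳ-≤ 2 G<pos) ⟩
  2 * pos y e + dKT x y                    ≡⟨ cong (λ p → 2 * p + dKT x y) e-min ⟩
  2 * minPos y S + dKT x y                 ∎
  where
  open ≤-Reasoning
  x′ = moveToFront e x
  G = ∑∑ (aheadPair e y)
  front : minPos x′ S ≤ 1
  front = ≤-trans (minPos≤pos x′ S e∈S) (≤-reflexive (pos-here (without e x) refl))
  G<pos : G < pos y e
  G<pos = ≤-<-trans (∑∑-aheadPair≤countBefore e y) (countBefore<pos (y-complete e))
  rearrange : ∀ d g → 2 + (d + 2 * g) ≡ 2 * suc g + d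
  rearrange = solve-∀

cost-mtfSeq≤ : ∀ {m} {x y₀ : Perm n} → Complete x → Complete y₀ →
  (Ss : Vec (Subset n) m) (ys : Vec (Perm n) m) → All IsPerm ys → (es : Vec (Fin n) m) →
  (∀ t → (lookup es t ∈ lookup Ss t) × (pos (lookup ys t) (lookup es t) ≡ minPos (lookup ys t) (lookup Ss t))) →
  cost x Ss (mtfSeq x es) ≤ 2 * cost y₀ Ss ys + dKT x y₀
cost-mtfSeq≤ _ _ [] [] [] [] _ = z≤n
cost-mtfSeq≤ {x = x} {y₀} x-complete _ (S ∷ Ss) (y ∷ ys) (y-perm ∷ ys-perm) (e ∷ es) es-min = begin
  minPos x′ S + dKT x x′ + cost x′ Ss (mtfSeq x′ es)
    ≤⟨ +-monoʳ-≤ (minPos x′ S + dKT x x′) rest ⟩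
  minPos x′ S + dKT x x′ + (2 * C + dKT x′ y)
    ≡⟨ +-exchange (minPos x′ S + dKT x x′) (2 * C) (dKT x′ y) ⟩
  minPos x′ S + dKT x x′ + dKT x′ y + 2 * C
    ≤⟨ +-monoˡ-≤ (2 * C) (moveToFront-amortised x-complete y-complete e∈S e-min) ⟩
  2 * minPos y S + dKT x y + 2 * C
    ≤⟨ +-monoˡ-≤ (2 * C) (+-monoʳ-≤ (2 * minPos y S) (dKT-triangle x y₀ y)) ⟩
  2 * minPos y S + (dKT x y₀ + dKT y₀ y) + 2 * C
    ≤⟨ +-monoˡ-≤ (2 * C) (+-monoʳ-≤ (2 * minPos y S) (+-monoʳ-≤ (dKT x y₀) (m≤n*m (dKT y₀ y) 2))) ⟩
  2 * minPos y S + (dKT x y₀ + 2 * dKT y₀ y) + 2 * C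
    ≡⟨ collect (minPos y S) (dKT x y₀) (dKT y₀ y) C ⟩
  2 * (minPos y S + dKT y₀ y + C) + dKT x y₀ ∎
  where
  open ≤-Reasoning
  x′ = moveToFront e x
  C = cost y Ss ys
  y-complete = IsPerm⇒Complete y-perm
  e∈S = proj₁ (es-min zero)
  e-min = proj₂ (es-min zero)
  rest : cost x′ Ss (mtfSeq x′ es) ≤ 2 * C + dKT x′ y
  rest = cost-mtfSeq≤ (moveToFront-complete e x-complete) y-complete Ss ys ys-perm es (es-min ∘ suc)
  +-exchange : ∀ a b c → a + (b + c) ≡ a + c + b
  +-exchange = solve-∀
  collect : ∀ q a b c → 2 * q + (a + 2 * b) + 2 * c ≡ 2 * (q + b + c) + a
  collect = solve-∀

lemma14 : ∀ {n m} (π0 : Perm n) → IsPerm π0 →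
    (Ss : Vec (Subset n) m) → (∀ t → Nonempty (lookup Ss t)) →
    (ys : Vec (Perm n) m) → All IsPerm ys →
    (∀ (zs : Vec (Perm n) m) → All IsPerm zs → cost π0 Ss ys ≤ cost π0 Ss zs) →
    (es : Vec (Fin n) m) →
    (∀ t → (lookup es t ∈ lookup Ss t) ×
           (pos (lookup ys t) (lookup es t) ≡ minPos (lookup ys t) (lookup Ss t))) →
    cost π0 Ss (mtfSeq π0 es) ≤ 2 * cost π0 Ss ys
lemma14 π0 π0-perm Ss _ ys ys-perm _ es es-min = begin
  cost π0 Ss (mtfSeq π0 es)        ≤⟨ cost-mtfSeq≤ π0-complete π0-complete Ss ys ys-perm es es-min ⟩
  2 * cost π0 Ss ys + dKT π0 π0    ≡⟨ cong (2 * cost π0 Ss ys +_) (dKT-self π0) ⟩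
  2 * cost π0 Ss ys + 0            ≡⟨ +-identityʳ _ ⟩
  2 * cost π0 Ss ys                ∎
  where
  open ≤-Reasoning
  π0-complete = IsPerm⇒Complete π0-perm
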